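{- Let $p$ be an odd prime, let $m,n$ be integers with $m\ge n+2\ge 3$, let $\lambda\in\mathbb{Z}_{p^m}^*$ have multiplicative order $p^{n+1}$, and let $\Gamma=\mathrm{MP}_{p^m,p^n,p^{m-1},\lambda}$. Then $\Gamma$ is a metacirculant. Moreover, $\mathrm{Aut}(\Gamma)$ acts transitively on the set of arcs (ordered pairs of adjacent vertices) of $\Gamma$ whose underlying edges lie in $\bigcup_{i\in\mathbb{Z}_{p^n}}E_i$.
   Context: With $H=\langle h\rangle\cong C_{p^m}$, for $i\in\mathbb{Z}_{p^n}$: $V_i=\{(h^j,i): j\in\mathbb{Z}_{p^m}\}$, $E_i=\{\{(h^j,i),(h^{j+kp^{m-1}+\lambda^i},i)\},\{(h^j,i),(h^{j-kp^{m-1}-\lambda^i},i)\}: k\in\mathbb{Z}_p, j\in\mathbb{Z}_{p^m}\}$, $E_{i,i+1}=\{\{(h^j,i),(h^j,i+1)\}: j\in\mathbb{Z}_{p^m}\}$ (layer indices mod $p^n$). $\Gamma=\mathrm{MP}_{p^m,p^n,p^{m-1},\lambda}$ has vertex set $\bigcup_i V_i$ and edge set $\bigcup_i(E_i\cup E_{i,i+1})$. For $M\ge1$, $N\ge2$, a graph of order $MN$ is an $(M,N)$-metacirculant if it has an automorphism $\sigma$ of order $N$ with $\langle\sigma\rangle$ semiregular on the vertices, and an automorphism $\tau$ normalizing $\langle\sigma\rangle$, cyclically permuting the $M$ orbits of $\langle\sigma\rangle$, with a cycle of length $M$ in its cycle decomposition; a metacirculant is an $(M,N)$-metacirculant for some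 $M,N$. -}

module Defs where

open import Data.Nat using (ℕ; zero; suc; _+_; _*_; _∸_; _^_; _≤_; _<_)
open import Data.Nat.Primality using (Prime)
open import Data.Nat.Divisibility using (_∣_)
open import Data.Nat.Coprimality using (Coprime)
open import Data.Fin using (Fin; toℕ)
open import Data.Product using (Σ; ∃; ∃-syntax; _×_; _,_; proj₁; proj₂)
open import Data.Sum using (_⊎_)
open import Relation.Nullary using (¬_)
open import Relation.Binary.PropositionalEquality using (_≡_)

infix 4 _≡_[mod_]
_≡_[mod_] : ℕ → ℕ → ℕ → Set
a ≡ b [mod d ] = (∃[ q ] a + q * d ≡ b) ⊎ (∃[ q ] b + q * d ≡ a)

IsUnitMod : ℕ → ℕ → Set
IsUnitMod M x = x < M × Coprime x M

HasMulOrder : (M x ord : ℕ) → Set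
HasMulOrder M x ord =
  0 < ord × (x ^ ord ≡ 1 [mod M ]) ×
  (∀ e → 0 < e → e < ord → ¬ (x ^ e ≡ 1 [mod M ]))

-- The graph  MP_{p^m, p^n, p^{m-1}, λ}.
-- Vertex (h^j , i) is represented by (j , i) ∈ ℤ_{p^m} × ℤ_{p^n}.

Vertex : (p m n : ℕ) → Set
Vertex p m n = Fin (p ^ m) × Fin (p ^ n)

-- edges in E_i : {(h^j,i),(h^{j ± (k p^{m-1} + λ^i)},i)}, k ∈ ℤ_p
InnerAdj : (p m n lam : ℕ) → Vertex p m n → Vertex p m n → Set
InnerAdj p m n lam (j , i) (j' , i') =
  i ≡ i' ×
  (∃[ k ] (k < p ×
     ((toℕ j' ≡ toℕ j + (k * p ^ (m ∸ 1) + lam ^ toℕ i) [mod p ^ m ])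
      ⊎ (toℕ j ≡ toℕ j' + (k * p ^ (m ∸ 1) + lam ^ toℕ i) [mod p ^ m ]))))

LayerAdj : (p m n : ℕ) → Vertex p m n → Vertex p m n → Set
LayerAdj p m n (j , i) (j' , i') =
  j ≡ j' ×
  ((toℕ i' ≡ toℕ i + 1 [mod p ^ n ]) ⊎ (toℕ i ≡ toℕ i' + 1 [mod p ^ n ]))

MPAdj : (p m n lam : ℕ) → Vertex p m n → Vertex p m n → Set
MPAdj p m n lam u v = InnerAdj p m n lam u v ⊎ LayerAdj p m n u v

record Perm (V : Set) : Set where
  field
    to       : V → V
    from     : V → V
    to-from  : ∀ x → to (from x) ≡ x
    from-to  : ∀ x → from (to x) ≡ x
open Perm public

iter : {V : Set} → ℕ → (V → V) → V → V
iter zero    f x = x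
iter (suc d) f x = f (iter d f x)

IsAut : {V : Set} → (V → V → Set) → Perm V → Set
IsAut {V} Adj π =
  ∀ (u v : V) → (Adj u v → Adj (to π u) (to π v)) × (Adj (to π u) (to π v) → Adj u v)

Aut : {V : Set} → (V → V → Set) → Set
Aut {V} Adj = Σ (Perm V) (IsAut Adj)

SameOrbit : {V : Set} → (V → V) → V → V → Set
SameOrbit σ u v = ∃[ d ] iter d σ u ≡ v

IsMNMetacirculant : {V : Set} → (card : ℕ) → (V → V → Set) → ℕ → ℕ → Set
IsMNMetacirculant {V} card Adj M N =
  1 ≤ M × 2 ≤ N × M * N ≡ card ×
  Σ (Aut Adj) λ σA → Σ (Aut Adj) λ τA →
    let σ = to (proj₁ σA) ; τ = to (proj₁ τA) in
    (∀ v → iter N σ v ≡ v) ×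
    (∀ d → 0 < d → d < N → ¬ (∀ v → iter d σ v ≡ v)) ×
    -- ⟨σ⟩ is semiregular: any power of σ fixing a vertex is the identity
    (∀ d v → iter d σ v ≡ v → ∀ w → iter d σ w ≡ w) ×
    (∃[ r ] ∀ v → τ (σ v) ≡ iter r σ (τ v)) ×
    -- τ cyclically permutes the M orbits of ⟨σ⟩ (the induced permutation
    -- on orbits is one M-cycle: every orbit returns after exactly M steps)
    (∀ v → SameOrbit σ v (iter M τ v) ×
           (∀ a → 0 < a → a < M → ¬ SameOrbit σ v (iter a τ v))) ×
    (∃[ v ] (iter M τ v ≡ v × (∀ a → 0 < a → a < M → ¬ iter a τ v ≡ v)))

IsMetacirculant : {V : Set} → (card : ℕ) → (V → V → Set) → Set
IsMetacirculant card Adj = ∃[ M ] ∃[ N ] IsMNMetacirculant card Adj M N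

ArcTransitiveOn : {V : Set} → (V → V → Set) → (V → V → Set) → Set
ArcTransitiveOn {V} Adj Sub =
  ∀ (u v u' v' : V) → Sub u v → Sub u' v' →
    Σ (Aut Adj) λ g → to (proj₁ g) u ≡ u' × to (proj₁ g) v ≡ v'

module Submission where

-- Write P = p^m, q = p^(m−1) and Q = p^n.  Everything is done with the affine
-- maps (j , i) ↦ (u·j + c , i + t) of ℤ_P × ℤ_Q.  Such a map is an
-- automorphism of Γ whenever u is a unit modulo P and u ≡ λ^t (mod q): the
-- layer edges are clearly preserved, and an inner step j ↦ j + k·q + λ^i of
-- layer i becomes a step of layer i + t because λ^Q ≡ 1 (mod q).  The
-- reflection j ↦ −j is a further automorphism.  The maps σ = (j + 1 , i) and
-- τ = (λ·j , i + 1) exhibit Γ as a (Q, P)-metacirculant, and the maps with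
-- u = λ^i·(1 + k·q), preceded by the reflection for backward arcs, carry the
-- base arc (0,0) → (1,0) onto every inner arc.

open import Defs
open import Data.Nat using (ℕ; _+_; _*_; _^_; _≤_)
open import Data.Nat.Primality using (Prime)
open import Data.Nat.Divisibility using (_∣_)
open import Data.Product using (_×_)
open import Relation.Nullary using (¬_)

open import Data.Nat
open import Data.Nat.Properties
open import Data.Nat.Divisibility
  using (divides; ∣1⇒≡1; ∣⇒≤; ∣-trans; n∣m*n; m∣m*n; ∣m⇒∣m*n; 1∣_; *-cancelʳ-∣; *-monoˡ-∣;
         ∣m+n∣m⇒∣n; m%n≡0⇒n∣m)
open import Data.Nat.DivMod
  using (_%_; _/_; _mod_; m≡m%n+[m/n]*n; m%n<n; [m+kn]%n≡m%n; m<n⇒m%n≡m; m/n*n≡m)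
open import Data.Nat.Primality using (euclidsLemma; prime⇒nonTrivial; prime⇒nonZero)
open import Data.Nat.Combinatorics using (_C_; nCk≡n!/k![n-k]!; k![n∸k]!∣n!; nCn≡1)
open import Data.Nat.Tactic.RingSolver using (solve-∀)
open import Data.Fin using (Fin; toℕ; fromℕ; inject₁) renaming (zero to fzero; suc to fsuc)
open import Data.Fin.Properties using (toℕ-fromℕ; toℕ-inject₁; toℕ<n; toℕ-fromℕ<; toℕ-injective)
open import Data.Vec.Functional using (Vector)
open import Data.Product using (Σ; ∃-syntax; _,_; proj₁; proj₂)
open import Data.Sum using (_⊎_; inj₁; inj₂; [_,_])
import Data.Sum as Sum
open import Data.Empty using (⊥-elim)
open import Function using (id)
open import Relation.Binary.Bundles using (Setoid)
open import Relation.Binary.PropositionalEquality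
  using (_≡_; _≢_; refl; sym; trans; cong; cong₂; subst; subst₂; module ≡-Reasoning)
import Relation.Binary.Reasoning.Setoid as SetoidReasoning
open import Algebra.Properties.Monoid.Sum +-0-monoid using (sum; sum-init-last)
import Algebra.Definitions.RawSemiring +-*-rawSemiring as Semiringℕ
import Algebra.Definitions.RawMonoid +-0-rawMonoid as Monoidℕ
open import Algebra.Properties.CommutativeSemiring.Binomial +-*-commutativeSemiring
  using (theorem; binomialTerm)

-- Congruence modulo d in the symmetric form a + qₗ·d = b + qᵣ·d, which
-- avoids truncated subtraction.  Being a record, the modulus d can be
-- inferred from the type, so lemmas below take it implicitly.
infix 4 _≈_⟨mod_⟩
record _≈_⟨mod_⟩ (a b d : ℕ) : Set where
  constructor ≈-intro
  field
    qₗ qᵣ   : ℕ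
    balance : a + qₗ * d ≡ b + qᵣ * d

≡⇒≈ : ∀ {d a b} → a ≡ b → a ≈ b ⟨mod d ⟩
≡⇒≈ refl = ≈-intro 0 0 refl

≈-refl : ∀ {d a} → a ≈ a ⟨mod d ⟩
≈-refl = ≡⇒≈ refl

≈-sym : ∀ {d a b} → a ≈ b ⟨mod d ⟩ → b ≈ a ⟨mod d ⟩
≈-sym (≈-intro qₗ qᵣ e) = ≈-intro qᵣ qₗ (sym e)

≈-trans : ∀ {d a b c} → a ≈ b ⟨mod d ⟩ → b ≈ c ⟨mod d ⟩ → a ≈ c ⟨mod d ⟩
≈-trans {d} {a} {b} {c} (≈-intro q₁ q₂ e) (≈-intro r₁ r₂ f) =
  ≈-intro (q₁ + r₁) (q₂ + r₂) (begin
    a + (q₁ + r₁) * d       ≡⟨ shift a q₁ r₁ d ⟩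
    (a + q₁ * d) + r₁ * d   ≡⟨ cong (_+ r₁ * d) e ⟩
    (b + q₂ * d) + r₁ * d   ≡⟨ swap b q₂ r₁ d ⟩
    (b + r₁ * d) + q₂ * d   ≡⟨ cong (_+ q₂ * d) f ⟩
    (c + r₂ * d) + q₂ * d   ≡⟨ swap c r₂ q₂ d ⟩
    (c + q₂ * d) + r₂ * d   ≡⟨ shift c q₂ r₂ d ⟨
    c + (q₂ + r₂) * d       ∎)
  where
  open ≡-Reasoning
  shift : ∀ x u v d → x + (u + v) * d ≡ (x + u * d) + v * d
  shift = solve-∀
  swap : ∀ x u v d → (x + u * d) + v * d ≡ (x + v * d) + u * d
  swap = solve-∀

modSetoid : ℕ → Setoid _ _
modSetoid d = record
  { Carrier = ℕ
  ; _≈_ = λ a b → a ≈ b ⟨mod d ⟩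
  ; isEquivalence = record { refl = ≈-refl ; sym = ≈-sym ; trans = ≈-trans }
  }

module ≈-Reasoning (d : ℕ) = SetoidReasoning (modSetoid d)

+-cong-≈ : ∀ {d a b c e} → a ≈ b ⟨mod d ⟩ → c ≈ e ⟨mod d ⟩ → a + c ≈ b + e ⟨mod d ⟩
+-cong-≈ {d} {a} {b} {c} {e} (≈-intro q₁ q₂ x) (≈-intro r₁ r₂ y) =
  ≈-intro (q₁ + r₁) (q₂ + r₂) (begin
    a + c + (q₁ + r₁) * d        ≡⟨ regroup a c q₁ r₁ d ⟩
    (a + q₁ * d) + (c + r₁ * d)  ≡⟨ cong₂ _+_ x y ⟩
    (b + q₂ * d) + (e + r₂ * d)  ≡⟨ regroup b e q₂ r₂ d ⟨
    b + e + (q₂ + r₂) * d        ∎)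
  where
  open ≡-Reasoning
  regroup : ∀ a c u v d → a + c + (u + v) * d ≡ (a + u * d) + (c + v * d)
  regroup = solve-∀

+-congˡ-≈ : ∀ {d a b} c → a ≈ b ⟨mod d ⟩ → c + a ≈ c + b ⟨mod d ⟩
+-congˡ-≈ c = +-cong-≈ (≈-refl {a = c})

+-congʳ-≈ : ∀ {d a b} c → a ≈ b ⟨mod d ⟩ → a + c ≈ b + c ⟨mod d ⟩
+-congʳ-≈ c a≈b = +-cong-≈ a≈b (≈-refl {a = c})

*-congˡ-≈ : ∀ {d a b} c → a ≈ b ⟨mod d ⟩ → c * a ≈ c * b ⟨mod d ⟩
*-congˡ-≈ {d} {a} {b} c (≈-intro q₁ q₂ x) =
  ≈-intro (c * q₁) (c * q₂) (begin
    c * a + c * q₁ * d  ≡⟨ factor c a q₁ d ⟩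
    c * (a + q₁ * d)    ≡⟨ cong (c *_) x ⟩
    c * (b + q₂ * d)    ≡⟨ factor c b q₂ d ⟨
    c * b + c * q₂ * d  ∎)
  where
  open ≡-Reasoning
  factor : ∀ c a q d → c * a + c * q * d ≡ c * (a + q * d)
  factor = solve-∀

*-congʳ-≈ : ∀ {d a b} c → a ≈ b ⟨mod d ⟩ → a * c ≈ b * c ⟨mod d ⟩
*-congʳ-≈ {d} {a} {b} c x rewrite *-comm a c | *-comm b c = *-congˡ-≈ c x

*-cong-≈ : ∀ {d a b c e} → a ≈ b ⟨mod d ⟩ → c ≈ e ⟨mod d ⟩ → a * c ≈ b * e ⟨mod d ⟩
*-cong-≈ {b = b} {c = c} x y = ≈-trans (*-congʳ-≈ c x) (*-congˡ-≈ b y)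

^-congˡ-≈ : ∀ {d a b} k → a ≈ b ⟨mod d ⟩ → a ^ k ≈ b ^ k ⟨mod d ⟩
^-congˡ-≈ zero    x = ≈-refl
^-congˡ-≈ (suc k) x = *-cong-≈ x (^-congˡ-≈ k x)

multiple≈0 : ∀ {d} k → k * d ≈ 0 ⟨mod d ⟩
multiple≈0 {d} k = ≈-intro 0 k (+-comm (k * d) 0)

+-multiple≈ : ∀ {d} a k → a + k * d ≈ a ⟨mod d ⟩
+-multiple≈ a k = ≈-trans (+-congˡ-≈ a (multiple≈0 k)) (≡⇒≈ (+-identityʳ a))

+-modulus≈ : ∀ {d} a → a + d ≈ a ⟨mod d ⟩
+-modulus≈ {d} a = ≈-intro 0 1 (trans (+-identityʳ (a + d)) (cong (a +_) (sym (+-identityʳ d))))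

unit-* : ∀ {d a b c e} → a * b ≈ 1 ⟨mod d ⟩ → c * e ≈ 1 ⟨mod d ⟩ → (a * c) * (b * e) ≈ 1 ⟨mod d ⟩
unit-* {d} {a} {b} {c} {e} ab≈1 ce≈1 = begin
  (a * c) * (b * e)   ≡⟨ interchange a c b e ⟩
  (a * b) * (c * e)   ≈⟨ *-cong-≈ ab≈1 ce≈1 ⟩
  1                   ∎
  where
  open ≈-Reasoning d
  interchange : ∀ a c b e → (a * c) * (b * e) ≡ (a * b) * (c * e)
  interchange = solve-∀

unit-^ : ∀ {d a b} k → a * b ≈ 1 ⟨mod d ⟩ → a ^ k * b ^ k ≈ 1 ⟨mod d ⟩
unit-^ zero    ab≈1 = ≈-refl
unit-^ {a = a} {b} (suc k) ab≈1 = unit-* {a = a} {b} {a ^ k} {b ^ k} ab≈1 (unit-^ k ab≈1)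

+-cancelˡ-≈ : ∀ {d} c {a b} → c + a ≈ c + b ⟨mod d ⟩ → a ≈ b ⟨mod d ⟩
+-cancelˡ-≈ c {a} {b} (≈-intro q₁ q₂ x) = ≈-intro q₁ q₂
  (+-cancelˡ-≡ c _ _ (trans (sym (+-assoc c a _)) (trans x (+-assoc c b _))))

∣-≈ : ∀ {d e a b} → d ∣ e → a ≈ b ⟨mod e ⟩ → a ≈ b ⟨mod d ⟩
∣-≈ {d} {_} {a} {b} (divides k refl) (≈-intro q₁ q₂ x) = ≈-intro (q₁ * k) (q₂ * k)
  (trans (cong (a +_) (reassoc q₁ k d)) (trans x (cong (b +_) (sym (reassoc q₂ k d)))))
  where
  reassoc : ∀ q k d → q * k * d ≡ q * (k * d)
  reassoc = solve-∀

≈-lift : ∀ {d a b} e → 1 ≤ e → a ≈ b ⟨mod d ⟩ → ∃[ w ] a ≈ b + w * d ⟨mod e * d ⟩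
≈-lift {d} {a} {b} (suc e) _ (≈-intro q₁ q₂ x) = q₂ + e * q₁ , ≈-intro q₁ 0 (begin
    a + q₁ * (suc e * d)          ≡⟨ expand a q₁ e d ⟩
    (a + q₁ * d) + e * q₁ * d     ≡⟨ cong (_+ e * q₁ * d) x ⟩
    (b + q₂ * d) + e * q₁ * d     ≡⟨ collect b q₂ e q₁ d ⟩
    b + (q₂ + e * q₁) * d + 0     ∎)
  where
  open ≡-Reasoning
  expand : ∀ a q e d → a + q * ((1 + e) * d) ≡ (a + q * d) + e * q * d
  expand = solve-∀
  collect : ∀ b q₂ e q₁ d → (b + q₂ * d) + e * q₁ * d ≡ b + (q₂ + e * q₁) * d + 0 * ((1 + e) * d)
  collect = solve-∀

*-scale-≈ : ∀ {d a b} e → a ≈ b ⟨mod d ⟩ → a * e ≈ b * e ⟨mod d * e ⟩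
*-scale-≈ {d} {a} {b} e (≈-intro q₁ q₂ x) = ≈-intro q₁ q₂ (begin
    a * e + q₁ * (d * e)   ≡⟨ pull a q₁ d e ⟩
    (a + q₁ * d) * e       ≡⟨ cong (_* e) x ⟩
    (b + q₂ * d) * e       ≡⟨ pull b q₂ d e ⟨
    b * e + q₂ * (d * e)   ∎)
  where
  open ≡-Reasoning
  pull : ∀ a q d e → a * e + q * (d * e) ≡ (a + q * d) * e
  pull = solve-∀

-- d ∸ 1 acts as −1 modulo d.
minus-one≈ : ∀ {d} x → 1 ≤ d → x + (d ∸ 1) * x ≈ 0 ⟨mod d ⟩
minus-one≈ {suc d} x _ = ≈-trans (≡⇒≈ (*-comm (suc d) x)) (multiple≈0 x)

minus-one-squared : ∀ {d} → 1 ≤ d → (d ∸ 1) * (d ∸ 1) ≈ 1 ⟨mod d ⟩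
minus-one-squared {suc d} _ = ≈-intro 2 (suc d) (square d)
  where
  square : ∀ d → d * d + 2 * (1 + d) ≡ 1 + (1 + d) * (1 + d)
  square = solve-∀

∣⇒≈0 : ∀ {d x} → d ∣ x → x ≈ 0 ⟨mod d ⟩
∣⇒≈0 (divides k refl) = multiple≈0 k

≈0⇒∣ : ∀ {d x} → x ≈ 0 ⟨mod d ⟩ → d ∣ x
≈0⇒∣ {d} {x} (≈-intro q₁ q₂ e) =
  ∣m+n∣m⇒∣n (subst (d ∣_) (trans (sym e) (+-comm x (q₁ * d))) (n∣m*n q₂)) (n∣m*n q₁)

≈-% : ∀ {d} .{{_ : NonZero d}} a → a ≈ a % d ⟨mod d ⟩
≈-% {d} a = ≈-intro 0 (a / d) (trans (+-identityʳ a) (m≡m%n+[m/n]*n a d))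

≈⇒%≡ : ∀ {d} .{{_ : NonZero d}} {a b} → a ≈ b ⟨mod d ⟩ → a % d ≡ b % d
≈⇒%≡ {d} {a} {b} (≈-intro q₁ q₂ x) =
  trans (sym ([m+kn]%n≡m%n a q₁ d)) (trans (cong (_% d) x) ([m+kn]%n≡m%n b q₂ d))

≈-residue : ∀ {d a b} → a < d → b < d → a ≈ b ⟨mod d ⟩ → a ≡ b
≈-residue {suc d} a<d b<d x =
  trans (sym (m<n⇒m%n≡m a<d)) (trans (≈⇒%≡ x) (m<n⇒m%n≡m b<d))

≡[mod]⇒≈ : ∀ {d a b} → a ≡ b [mod d ] → a ≈ b ⟨mod d ⟩
≡[mod]⇒≈ {b = b} (inj₁ (q , e)) = ≈-intro q 0 (trans e (sym (+-identityʳ b)))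
≡[mod]⇒≈ {a = a} (inj₂ (q , e)) = ≈-intro 0 q (trans (+-identityʳ a) (sym e))

split-multiple : ∀ c d {r s} → r ≤ s → c + (s ∸ r) * d + r * d ≡ c + s * d
split-multiple c d {r} {s} r≤s = trans (+-assoc c _ _)
  (cong (c +_) (trans (sym (*-distribʳ-+ d (s ∸ r) r)) (cong (_* d) (m∸n+n≡m r≤s))))

≈⇒≡[mod] : ∀ {d a b} → a ≈ b ⟨mod d ⟩ → a ≡ b [mod d ]
≈⇒≡[mod] {d} {a} {b} (≈-intro q₁ q₂ x) with ≤-total q₁ q₂
... | inj₁ q₁≤q₂ = inj₂ (q₂ ∸ q₁ , +-cancelʳ-≡ (q₁ * d) _ _ (trans (split-multiple b d q₁≤q₂) (sym x)))
... | inj₂ q₂≤q₁ = inj₁ (q₁ ∸ q₂ , +-cancelʳ-≡ (q₂ * d) _ _ (trans (split-multiple a d q₂≤q₁) x))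

≈-residue-form : ∀ {d a b} → b < d → a ≈ b ⟨mod d ⟩ → ∃[ q ] a ≡ b + q * d
≈-residue-form {d} {a} {b} b<d a≈b with ≈⇒≡[mod] (≈-sym a≈b)
... | inj₁ (q , b+qd≡a)         = q , sym b+qd≡a
... | inj₂ (zero , a+0≡b)       = 0 , trans (sym (+-identityʳ a)) (trans a+0≡b (sym (+-identityʳ b)))
... | inj₂ (suc q , a+d+qd≡b)   =
  ⊥-elim (<⇒≱ b<d (subst (d ≤_) a+d+qd≡b (≤-trans (m≤m+n d (q * d)) (m≤n+m _ a))))

prime∤! : ∀ {p j} → Prime p → j < p → ¬ p ∣ j !
prime∤! {p} {zero} prime-p _ p∣1 =
  <⇒≢ (nonTrivial⇒n>1 p {{prime⇒nonTrivial prime-p}}) (sym (∣1⇒≡1 p∣1))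
prime∤! {p} {suc j} prime-p j<p p∣j! with euclidsLemma (suc j) (j !) prime-p p∣j!
... | inj₁ p∣1+j = <⇒≱ j<p (∣⇒≤ p∣1+j)
... | inj₂ p∣j!′ = prime∤! prime-p (<-trans (n<1+n j) j<p) p∣j!′

-- A prime p divides the binomial coefficients p C k for 0 < k < p, since
-- p divides p! = (p C k)·k!·(p−k)! but neither k! nor (p−k)!.
prime∣C : ∀ {p k} → Prime p → 0 < k → k < p → p ∣ p C k
prime∣C {suc p₁} {k} prime-p 0<k k<p =
  [ id , (λ p∣k!·[p∸k]! → ⊥-elim ([ prime∤! prime-p k<p , prime∤! prime-p p∸k<p ]
                                     (euclidsLemma (k !) ((p ∸ k) !) prime-p p∣k!·[p∸k]!))) ]
  (euclidsLemma (p C k) (k ! * (p ∸ k) !) prime-p p∣product)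
  where
  p : ℕ
  p = suc p₁
  instance
    k![p∸k]!≢0 : NonZero (k ! * (p ∸ k) !)
    k![p∸k]!≢0 = k !* (p ∸ k) !≢0
  p∸k<p : p ∸ k < p
  p∸k<p = ∸-monoʳ-< 0<k (<⇒≤ k<p)
  C-times : (p C k) * (k ! * (p ∸ k) !) ≡ p !
  C-times = trans (cong (_* (k ! * (p ∸ k) !)) (nCk≡n!/k![n-k]! (<⇒≤ k<p)))
                  (m/n*n≡m (k![n∸k]!∣n! (<⇒≤ k<p)))
  p∣product : p ∣ (p C k) * (k ! * (p ∸ k) !)
  p∣product = subst (p ∣_) (sym C-times) (m∣m*n (p₁ !))

-- The power and multiple operations of a generic semiring, specialised to
-- ℕ (as used by the library's binomial theorem), are ℕ's _^_ and _*_.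
^-generic : ∀ x n → x Semiringℕ.^ n ≡ x ^ n
^-generic x zero    = refl
^-generic x (suc n) = cong (x *_) (^-generic x n)

×-generic : ∀ n x → n Monoidℕ.× x ≡ n * x
×-generic zero    x = refl
×-generic (suc n) x = cong (x +_) (×-generic n x)

sum≈0 : ∀ {d n} (t : Vector ℕ n) → (∀ i → t i ≈ 0 ⟨mod d ⟩) → sum t ≈ 0 ⟨mod d ⟩
sum≈0 {n = zero}  t t≈0 = ≈-refl
sum≈0 {n = suc n} t t≈0 = +-cong-≈ (t≈0 fzero) (sum≈0 (λ i → t (fsuc i)) (λ i → t≈0 (fsuc i)))

-- Freshman's dream: (x + 1)^p ≡ x^p + 1 (mod p).  In the binomial expansion
-- only the first and last terms survive, the others being multiples of p.
freshman : ∀ {p} → Prime p → ∀ x → (x + 1) ^ p ≈ x ^ p + 1 ⟨mod p ⟩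
freshman {suc p₁} prime-p x = begin
  (x + 1) ^ p                                   ≡⟨ ^-generic (x + 1) p ⟨
  (x + 1) Semiringℕ.^ p                         ≡⟨ theorem p x 1 ⟩
  T fzero + sum (λ i → T (fsuc i))              ≡⟨ cong (T fzero +_) (sum-init-last (λ i → T (fsuc i))) ⟩
  T fzero + (sum middle + T (fsuc (fromℕ p₁)))  ≈⟨ +-cong-≈ (≡⇒≈ first) (+-cong-≈ (sum≈0 middle middle≈0) (≡⇒≈ last)) ⟩
  1 + (0 + x ^ p)                               ≡⟨ +-comm 1 (x ^ p) ⟩
  x ^ p + 1                                     ∎
  where
  open ≈-Reasoning (suc p₁)
  p : ℕ
  p = suc p₁
  T : Fin (suc p) → ℕ
  T = binomialTerm x 1 p
  middle : Vector ℕ p₁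
  middle i = T (fsuc (inject₁ i))
  first : T fzero ≡ 1
  first = trans (+-identityʳ (1 * 1 Semiringℕ.^ p)) (trans (*-identityˡ (1 Semiringℕ.^ p))
                                                          (trans (^-generic 1 p) (^-zeroˡ p)))
  last : T (fsuc (fromℕ p₁)) ≡ x ^ p
  last rewrite toℕ-fromℕ p₁ | nCn≡1 p | n∸n≡0 p₁ =
    trans (+-identityʳ (x Semiringℕ.^ p * 1)) (trans (*-identityʳ (x Semiringℕ.^ p)) (^-generic x p))
  middle≈0 : ∀ i → middle i ≈ 0 ⟨mod p ⟩
  middle≈0 i = ∣⇒≈0 (subst (p ∣_) (sym (×-generic (p C k) powers))
                             (∣m⇒∣m*n powers (prime∣C prime-p (s≤s z≤n) k<p)))
    where
    k powers : ℕ
    k = suc (toℕ (inject₁ i))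
    powers = x Semiringℕ.^ k * 1 Semiringℕ.^ (p ∸ k)
    k<p : k < p
    k<p = s≤s (subst (_< p₁) (sym (toℕ-inject₁ i)) (toℕ<n i))

fermat : ∀ {p} → Prime p → ∀ x → x ^ p ≈ x ⟨mod p ⟩
fermat {suc p₁} prime-p zero = ≈-refl
fermat {p} prime-p (suc x) = begin
  suc x ^ p     ≡⟨ cong (_^ p) (+-comm 1 x) ⟩
  (x + 1) ^ p   ≈⟨ freshman prime-p x ⟩
  x ^ p + 1     ≈⟨ +-congʳ-≈ 1 (fermat prime-p x) ⟩
  x + 1         ≡⟨ +-comm x 1 ⟩
  suc x         ∎
  where open ≈-Reasoning p

fermat-iterated : ∀ {p} → Prime p → ∀ k x → x ^ (p ^ k) ≈ x ⟨mod p ⟩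
fermat-iterated prime-p zero    x = ≡⇒≈ (*-identityʳ x)
fermat-iterated {p} prime-p (suc k) x = begin
  x ^ (p * p ^ k)     ≡⟨ ^-*-assoc x p (p ^ k) ⟨
  (x ^ p) ^ (p ^ k)   ≈⟨ ^-congˡ-≈ (p ^ k) (fermat prime-p x) ⟩
  x ^ (p ^ k)         ≈⟨ fermat-iterated prime-p k x ⟩
  x                   ∎
  where open ≈-Reasoning p

prime∤1+multiple : ∀ {p} → Prime p → ∀ e → ¬ p ∣ 1 + e * p
prime∤1+multiple {p} prime-p e p∣1+ep =
  <⇒≢ (nonTrivial⇒n>1 p {{prime⇒nonTrivial prime-p}})
      (sym (∣1⇒≡1 (∣m+n∣m⇒∣n (subst (p ∣_) (+-comm 1 (e * p)) p∣1+ep) (n∣m*n e))))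

prime-power-cancel : ∀ {p} → Prime p → ∀ s {x u} → ¬ p ∣ u → p ^ s ∣ x * u → p ^ s ∣ x
prime-power-cancel prime-p zero {x} _ _ = 1∣ x
prime-power-cancel {p} prime-p (suc s) {x} {u} p∤u p^[1+s]∣xu =
  lift (prime-power-cancel prime-p s {x} {u} p∤u (∣-trans (n∣m*n p) p^[1+s]∣xu)) p^[1+s]∣xu
  where
  instance
    p^s≢0 : NonZero (p ^ s)
    p^s≢0 = m^n≢0 p s {{prime⇒nonZero prime-p}}
  regroup : ∀ c q u → c * q * u ≡ c * u * q
  regroup = solve-∀
  -- writing y = c·p^s, the extra factor p must divide c
  lift : ∀ {y} → p ^ s ∣ y → p ^ suc s ∣ y * u → p ^ suc s ∣ y
  lift (divides c refl) p^[1+s]∣cp^su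
    with euclidsLemma c u prime-p
           (*-cancelʳ-∣ (p ^ s) (subst (p * p ^ s ∣_) (regroup c (p ^ s) u) p^[1+s]∣cp^su))
  ... | inj₁ p∣c = *-monoˡ-∣ (p ^ s) p∣c
  ... | inj₂ p∣u = ⊥-elim (p∤u p∣u)

triangle : ℕ → ℕ
triangle zero    = 0
triangle (suc k) = triangle k + k

-- For odd k = 1 + 2h, T(k) = k·h; in particular an odd prime divides T(p).
triangle-odd : ∀ h → triangle (1 + h * 2) ≡ (1 + h * 2) * h
triangle-odd zero    = refl
triangle-odd (suc h) =
  trans (cong (λ t → t + suc (h * 2) + suc (suc (h * 2))) (triangle-odd h)) (step h)
  where
  step : ∀ h → (1 + h * 2) * h + (1 + h * 2) + (2 + h * 2) ≡ (3 + h * 2) * (1 + h)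
  step = solve-∀

binomial-cubic : ∀ d k → ∃[ r ] (1 + d) ^ k ≡ 1 + k * d + triangle k * (d * d) + d * d * d * r
binomial-cubic d zero    = 0 , base d
  where
  base : ∀ d → 1 ≡ 1 + 0 * d + 0 * (d * d) + d * d * d * 0
  base = solve-∀
binomial-cubic d (suc k) with binomial-cubic d k
... | r , expansion = triangle k + r + d * r ,
  trans (cong ((1 + d) *_) expansion) (step d k (triangle k) r)
  where
  step : ∀ d k t r → (1 + d) * (1 + k * d + t * (d * d) + d * d * d * r)
                   ≡ 1 + (1 + k) * d + (t + k) * (d * d) + d * d * d * (t + r + d * r)
  step = solve-∀

odd⇒1+2h : ∀ p → ¬ 2 ∣ p → p ≡ 1 + (p / 2) * 2
odd⇒1+2h p 2∤p = trans (m≡m%n+[m/n]*n p 2) (cong (_+ (p / 2) * 2) p%2≡1)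
  where
  p%2≡1 : p % 2 ≡ 1
  p%2≡1 with p % 2 | m%n<n p 2 | m%n≡0⇒n∣m p 2
  ... | 0           | _            | 2∣p = ⊥-elim (2∤p (2∣p refl))
  ... | 1           | _            | _   = refl
  ... | suc (suc _) | s≤s (s≤s ()) | _

-- With d = a·p the expansion
-- gives (1 + d)^p = 1 + d·u·p where u = 1 + e·p is prime to p.
lift-exponent : ∀ {p} → Prime p → ¬ 2 ∣ p → ∀ s a →
  (1 + a * p) ^ p ≈ 1 ⟨mod p ^ suc s ⟩ → 1 + a * p ≈ 1 ⟨mod p ^ s ⟩
lift-exponent {p} prime-p 2∤p s a power≈1 with binomial-cubic (a * p) p
... | r , expansion = +-congˡ-≈ 1 (∣⇒≈0 p^s∣d)
  where
  h d e u : ℕ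
  h = p / 2
  d = a * p
  e = a * (h + a * r)
  u = 1 + e * p
  triangle-p : triangle p ≡ p * h
  triangle-p = trans (cong triangle p-odd) (trans (triangle-odd h) (cong (_* h) (sym p-odd)))
    where
    p-odd : p ≡ 1 + h * 2
    p-odd = odd⇒1+2h p 2∤p
  rearrange : ∀ a p h r → 1 + p * (a * p) + p * h * ((a * p) * (a * p)) + (a * p) * (a * p) * (a * p) * r
                        ≡ 1 + (a * p) * (1 + (a * (h + a * r)) * p) * p
  rearrange = solve-∀
  power≡ : (1 + d) ^ p ≡ 1 + d * u * p
  power≡ = trans expansion (trans (cong (λ t → 1 + p * d + t * (d * d) + d * d * d * r) triangle-p)
                                 (rearrange a p h r))
  dup≈0 : d * u * p ≈ 0 ⟨mod p ^ suc s ⟩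
  dup≈0 = +-cancelˡ-≈ 1 (≈-trans (≡⇒≈ (sym power≡)) (≈-trans power≈1 (≡⇒≈ (sym (+-identityʳ 1)))))
  p^s∣du : p ^ s ∣ d * u
  p^s∣du = *-cancelʳ-∣ p {{prime⇒nonZero prime-p}} (subst (_∣ d * u * p) (*-comm p (p ^ s)) (≈0⇒∣ dup≈0))
  p^s∣d : p ^ s ∣ d
  p^s∣d = prime-power-cancel prime-p s (prime∤1+multiple prime-p e) p^s∣du

≡1-mod-prime : ∀ {p} → Prime p → ∀ s n lam → lam ^ (p ^ suc n) ≈ 1 ⟨mod p ^ suc s ⟩ → lam ≈ 1 ⟨mod p ⟩
≡1-mod-prime {p} prime-p s n lam order =
  ≈-trans (≈-sym (fermat-iterated prime-p (suc n) lam)) (∣-≈ (m∣m*n {p} (p ^ s)) order)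

order-descent : ∀ {p} → Prime p → ¬ 2 ∣ p → ∀ s n lam →
  lam ^ (p ^ suc n) ≈ 1 ⟨mod p ^ suc s ⟩ → lam ^ (p ^ n) ≈ 1 ⟨mod p ^ s ⟩
order-descent {p} prime-p 2∤p s n lam order = descend (≈-residue-form 1<p y≈1)
  where
  1<p : 1 < p
  1<p = nonTrivial⇒n>1 p {{prime⇒nonTrivial prime-p}}
  y≈1 : lam ^ (p ^ n) ≈ 1 ⟨mod p ⟩
  y≈1 = ≈-trans (^-congˡ-≈ (p ^ n) (≡1-mod-prime prime-p s n lam order)) (≡⇒≈ (^-zeroˡ (p ^ n)))
  descend : ∃[ a ] lam ^ (p ^ n) ≡ 1 + a * p → lam ^ (p ^ n) ≈ 1 ⟨mod p ^ s ⟩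
  descend (a , y≡1+ap) =
    ≈-trans (≡⇒≈ y≡1+ap) (lift-exponent prime-p 2∤p s a (≈-trans (≡⇒≈ power≡) order))
    where
    power≡ : (1 + a * p) ^ p ≡ lam ^ (p ^ suc n)
    power≡ = trans (cong (_^ p) (sym y≡1+ap))
                   (trans (^-*-assoc lam (p ^ n) p) (cong (lam ^_) (*-comm (p ^ n) p)))

module _ {V : Set} (Adj : V → V → Set) where

  aut-from-inverses : (f g : V → V) → (∀ x → f (g x) ≡ x) → (∀ x → g (f x) ≡ x) →
    (∀ x y → Adj x y → Adj (f x) (f y)) → (∀ x y → Adj x y → Adj (g x) (g y)) → Aut Adj
  aut-from-inverses f g fg gf f-adj g-adj =
    record { to = f ; from = g ; to-from = fg ; from-to = gf } ,
    λ x y → f-adj x y , λ fx~fy → subst₂ Adj (gf x) (gf y) (g-adj (f x) (f y) fx~fy)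

  from-preserves : ∀ π → IsAut Adj π → ∀ x y → Adj x y → Adj (from π x) (from π y)
  from-preserves π π-adj x y x~y =
    proj₂ (π-adj (from π x) (from π y)) (subst₂ Adj (sym (to-from π x)) (sym (to-from π y)) x~y)

  aut-inverse : Aut Adj → Aut Adj
  aut-inverse (π , π-adj) = aut-from-inverses (from π) (to π) (from-to π) (to-from π)
    (from-preserves π π-adj) (λ x y → proj₁ (π-adj x y))

  aut-compose : Aut Adj → Aut Adj → Aut Adj
  aut-compose (π , π-adj) (ρ , ρ-adj) =
    aut-from-inverses (λ x → to π (to ρ x)) (λ x → from ρ (from π x))
      (λ x → trans (cong (to π) (to-from ρ (from π x))) (to-from π x))
      (λ x → trans (cong (from ρ) (from-to π (to ρ x))) (from-to ρ x))
      (λ x y x~y → proj₁ (π-adj (to ρ x) (to ρ y)) (proj₁ (ρ-adj x y) x~y))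
      (λ x y x~y → from-preserves ρ ρ-adj (from π x) (from π y) (from-preserves π π-adj x y x~y))

  apply : Aut Adj → V → V
  apply g = to (proj₁ g)

  -- If every arc of Sub is the image of one fixed arc (b₀ , b₁), then Aut is
  -- transitive on the arcs of Sub: compose one such map with another's inverse.
  arc-transitive-via-base : ∀ {Sub : V → V → Set} (b₀ b₁ : V) →
    (∀ x y → Sub x y → Σ (Aut Adj) λ g → apply g b₀ ≡ x × apply g b₁ ≡ y) →
    ArcTransitiveOn Adj Sub
  arc-transitive-via-base b₀ b₁ reach x y x′ y′ xy x′y′ with reach x y xy | reach x′ y′ x′y′
  ... | g , gb₀ , gb₁ | h , hb₀ , hb₁ = aut-compose h (aut-inverse g) , via gb₀ hb₀ , via gb₁ hb₁
    where
    via : ∀ {b z z′} → apply g b ≡ z → apply h b ≡ z′ → apply h (from (proj₁ g) z) ≡ z′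
    via {b} refl refl = cong (apply h) (from-to (proj₁ g) b)

module MP (p m₀ n lam lam⁻¹ : ℕ) .{{_ : NonTrivial p}}
          (lam-unit   : lam * lam⁻¹ ≈ 1 ⟨mod p ^ (2 + m₀) ⟩)
          (lam≡1      : lam ≈ 1 ⟨mod p ⟩)
          (lam-period : lam ^ (p ^ n) ≈ 1 ⟨mod p ^ (1 + m₀) ⟩) where

  P q Q : ℕ
  P = p ^ (2 + m₀)
  q = p ^ (1 + m₀)
  Q = p ^ n

  instance
    p≢0 : NonZero p
    p≢0 = nonTrivial⇒nonZero p
    P≢0 : NonZero P
    P≢0 = m^n≢0 p (2 + m₀)
    Q≢0 : NonZero Q
    Q≢0 = m^n≢0 p n

  1≤P : 1 ≤ P
  1≤P = m^n>0 p (2 + m₀)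

  1≤Q : 1 ≤ Q
  1≤Q = m^n>0 p n

  q∣P : q ∣ P
  q∣P = n∣m*n p

  V : Set
  V = Vertex p (2 + m₀) n

  Adj : V → V → Set
  Adj = MPAdj p (2 + m₀) n lam

  pos layer : V → ℕ
  pos x   = toℕ (proj₁ x)
  layer x = toℕ (proj₂ x)

  vertex : ℕ → ℕ → V
  vertex a b = a mod P , b mod Q

  pos-vertex : ∀ a b → pos (vertex a b) ≈ a ⟨mod P ⟩
  pos-vertex a b = ≈-trans (≡⇒≈ (toℕ-fromℕ< (m%n<n a P))) (≈-sym (≈-% a))

  layer-vertex : ∀ a b → layer (vertex a b) ≈ b ⟨mod Q ⟩
  layer-vertex a b = ≈-trans (≡⇒≈ (toℕ-fromℕ< (m%n<n b Q))) (≈-sym (≈-% b))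

  vertex-ext : ∀ {x y} → pos x ≡ pos y → layer x ≡ layer y → x ≡ y
  vertex-ext {_ , _} {_ , _} e f = cong₂ _,_ (toℕ-injective e) (toℕ-injective f)

  vertex≡ : ∀ {a b} x → a ≈ pos x ⟨mod P ⟩ → b ≈ layer x ⟨mod Q ⟩ → vertex a b ≡ x
  vertex≡ {a} {b} x a≈ b≈ = vertex-ext
    (≈-residue (toℕ<n (proj₁ (vertex a b))) (toℕ<n (proj₁ x)) (≈-trans (pos-vertex a b) a≈))
    (≈-residue (toℕ<n (proj₂ (vertex a b))) (toℕ<n (proj₂ x)) (≈-trans (layer-vertex a b) b≈))

  vertex-cong : ∀ {a a′ b b′} → a ≈ a′ ⟨mod P ⟩ → b ≈ b′ ⟨mod Q ⟩ → vertex a b ≡ vertex a′ b′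
  vertex-cong {a′ = a′} {b′ = b′} a≈ b≈ =
    vertex≡ (vertex a′ b′) (≈-trans a≈ (≈-sym (pos-vertex a′ b′))) (≈-trans b≈ (≈-sym (layer-vertex a′ b′)))

  affine : ℕ → ℕ → ℕ → V → V
  affine u c t x = vertex (u * pos x + c) (layer x + t)

  affine-cong : ∀ {u u′ c c′ t t′} → u ≈ u′ ⟨mod P ⟩ → c ≈ c′ ⟨mod P ⟩ → t ≈ t′ ⟨mod Q ⟩ →
    ∀ x → affine u c t x ≡ affine u′ c′ t′ x
  affine-cong u≈ c≈ t≈ x = vertex-cong (+-cong-≈ (*-congʳ-≈ (pos x) u≈) c≈) (+-congˡ-≈ (layer x) t≈)

  affine-identity : ∀ {u c t} → u ≈ 1 ⟨mod P ⟩ → c ≈ 0 ⟨mod P ⟩ → t ≈ 0 ⟨mod Q ⟩ → ∀ x → affine u c t x ≡ x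
  affine-identity u≈1 c≈0 t≈0 x = vertex≡ x
    (≈-trans (+-cong-≈ (*-congʳ-≈ (pos x) u≈1) c≈0) (≡⇒≈ (trans (+-identityʳ (1 * pos x)) (*-identityˡ (pos x)))))
    (≈-trans (+-congˡ-≈ (layer x) t≈0) (≡⇒≈ (+-identityʳ (layer x))))

  affine-∘ : ∀ u c t u′ c′ t′ x → affine u c t (affine u′ c′ t′ x) ≡ affine (u * u′) (u * c′ + c) (t′ + t) x
  affine-∘ u c t u′ c′ t′ x = vertex-cong
    (≈-trans (+-congʳ-≈ c (*-congˡ-≈ u (pos-vertex (u′ * pos x + c′) (layer x + t′)))) (≡⇒≈ (regroup u u′ (pos x) c′ c)))
    (≈-trans (+-congʳ-≈ t (layer-vertex (u′ * pos x + c′) (layer x + t′))) (≡⇒≈ (+-assoc (layer x) t′ t)))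
    where
    regroup : ∀ u u′ j c′ c → u * (u′ * j + c′) + c ≡ u * u′ * j + (u * c′ + c)
    regroup = solve-∀

  pos-affine : ∀ u c t x → pos (affine u c t x) ≈ u * pos x + c ⟨mod P ⟩
  pos-affine u c t x = pos-vertex (u * pos x + c) (layer x + t)

  layer-affine : ∀ u c t x → layer (affine u c t x) ≈ layer x + t ⟨mod Q ⟩
  layer-affine u c t x = layer-vertex (u * pos x + c) (layer x + t)

  layer-affine-0 : ∀ u c x → layer (affine u c 0 x) ≡ layer x
  layer-affine-0 u c x = ≈-residue (toℕ<n (proj₂ (affine u c 0 x))) (toℕ<n (proj₂ x))
    (≈-trans (layer-affine u c 0 x) (≡⇒≈ (+-identityʳ (layer x))))

  lam-power-period : ∀ a k → lam ^ (a + k * Q) ≈ lam ^ a ⟨mod q ⟩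
  lam-power-period a k = begin
    lam ^ (a + k * Q)         ≡⟨ ^-distribˡ-+-* lam a (k * Q) ⟩
    lam ^ a * lam ^ (k * Q)   ≡⟨ cong (λ e → lam ^ a * lam ^ e) (*-comm k Q) ⟩
    lam ^ a * lam ^ (Q * k)   ≡⟨ cong (lam ^ a *_) (^-*-assoc lam Q k) ⟨
    lam ^ a * (lam ^ Q) ^ k   ≈⟨ *-congˡ-≈ (lam ^ a) (^-congˡ-≈ k lam-period) ⟩
    lam ^ a * 1 ^ k           ≡⟨ cong (lam ^ a *_) (^-zeroˡ k) ⟩
    lam ^ a * 1               ≡⟨ *-identityʳ (lam ^ a) ⟩
    lam ^ a                   ∎
    where open ≈-Reasoning q

  lam-power-cong : ∀ {a b} → a ≈ b ⟨mod Q ⟩ → lam ^ a ≈ lam ^ b ⟨mod q ⟩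
  lam-power-cong {a} {b} (≈-intro k₁ k₂ a+k₁Q≡b+k₂Q) = begin
    lam ^ a              ≈⟨ lam-power-period a k₁ ⟨
    lam ^ (a + k₁ * Q)   ≡⟨ cong (lam ^_) a+k₁Q≡b+k₂Q ⟩
    lam ^ (b + k₂ * Q)   ≈⟨ lam-power-period b k₂ ⟩
    lam ^ b              ∎
    where open ≈-Reasoning q

  record Step (I x y : ℕ) : Set where
    constructor step
    field
      k     : ℕ
      k<p   : k < p
      lands : y ≈ x + (k * q + lam ^ I) ⟨mod P ⟩

  Inner : V → V → Set
  Inner x y = proj₂ x ≡ proj₂ y × (Step (layer x) (pos x) (pos y) ⊎ Step (layer x) (pos y) (pos x))

  inner⇒Inner : ∀ x y → InnerAdj p (2 + m₀) n lam x y → Inner x y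
  inner⇒Inner (_ , _) (_ , _) (refl , k , k<p , inj₁ e) = refl , inj₁ (step k k<p (≡[mod]⇒≈ e))
  inner⇒Inner (_ , _) (_ , _) (refl , k , k<p , inj₂ e) = refl , inj₂ (step k k<p (≡[mod]⇒≈ e))

  Inner⇒inner : ∀ x y → Inner x y → InnerAdj p (2 + m₀) n lam x y
  Inner⇒inner (_ , _) (_ , _) (refl , inj₁ (step k k<p e)) = refl , k , k<p , inj₁ (≈⇒≡[mod] e)
  Inner⇒inner (_ , _) (_ , _) (refl , inj₂ (step k k<p e)) = refl , k , k<p , inj₂ (≈⇒≡[mod] e)

  shift-power : ∀ t I {u I′} → u ≈ lam ^ t ⟨mod q ⟩ → I′ ≈ I + t ⟨mod Q ⟩ →
    u * lam ^ I ≈ lam ^ I′ ⟨mod q ⟩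
  shift-power t I {u} {I′} u≈ I′≈ = begin
    u * lam ^ I         ≈⟨ *-congʳ-≈ (lam ^ I) u≈ ⟩
    lam ^ t * lam ^ I   ≡⟨ ^-distribˡ-+-* lam t I ⟨
    lam ^ (t + I)       ≡⟨ cong (lam ^_) (+-comm t I) ⟩
    lam ^ (I + t)       ≈⟨ lam-power-cong I′≈ ⟨
    lam ^ I′            ∎
    where open ≈-Reasoning q

  scale-step-coefficient : ∀ {u c I I′ x y x′ y′} k w →
    x′ ≈ u * x + c ⟨mod P ⟩ → y′ ≈ u * y + c ⟨mod P ⟩ →
    y ≈ x + (k * q + lam ^ I) ⟨mod P ⟩ → u * lam ^ I ≈ lam ^ I′ + w * q ⟨mod P ⟩ →
    y′ ≈ x′ + ((u * k + w) % p * q + lam ^ I′) ⟨mod P ⟩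
  scale-step-coefficient {u} {c} {I} {I′} {x} {y} {x′} {y′} k w x′≈ y′≈ y≈ uλ^I≈ = begin
    y′                                              ≈⟨ y′≈ ⟩
    u * y + c                                       ≈⟨ +-congʳ-≈ c (*-congˡ-≈ u y≈) ⟩
    u * (x + (k * q + lam ^ I)) + c                 ≡⟨ distribute u x k q (lam ^ I) c ⟩
    (u * x + c) + (u * k * q + u * lam ^ I)         ≈⟨ +-congˡ-≈ (u * x + c) (+-congˡ-≈ (u * k * q) uλ^I≈) ⟩
    (u * x + c) + (u * k * q + (lam ^ I′ + w * q))  ≡⟨ collect (u * x + c) u k q (lam ^ I′) w ⟩
    (u * x + c) + ((u * k + w) * q + lam ^ I′)
      ≈⟨ +-cong-≈ (≈-sym x′≈) (+-congʳ-≈ (lam ^ I′) (*-scale-≈ q (≈-% {p} (u * k + w)))) ⟩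
    x′ + ((u * k + w) % p * q + lam ^ I′)           ∎
    where
    open ≈-Reasoning P
    distribute : ∀ u x k q l c → u * (x + (k * q + l)) + c ≡ (u * x + c) + (u * k * q + u * l)
    distribute = solve-∀
    collect : ∀ a u k q l w → a + (u * k * q + (l + w * q)) ≡ a + ((u * k + w) * q + l)
    collect = solve-∀

  -- Multiplying by u ≡ λ^t (mod q) turns an E_I step into an E_I′ step,
  -- where I′ ≡ I + t (mod Q): u·λ^I agrees with λ^I′ up to a multiple of q,
  -- which is absorbed into the coefficient k.
  scale-step : ∀ {u x y x′ y′ I I′} t c → u ≈ lam ^ t ⟨mod q ⟩ → I′ ≈ I + t ⟨mod Q ⟩ →
    x′ ≈ u * x + c ⟨mod P ⟩ → y′ ≈ u * y + c ⟨mod P ⟩ → Step I x y → Step I′ x′ y′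
  scale-step {u} {x} {y} {x′} {y′} {I} {I′} t c u≈ I′≈ x′≈ y′≈ (step k k<p y≈) =
    step ((u * k + w) % p) (m%n<n (u * k + w) p)
      (scale-step-coefficient {u} {c} {I} {I′} {x} {y} {x′} {y′} k w x′≈ y′≈ y≈ uλ^I≈)
    where
    lifted : ∃[ w ] u * lam ^ I ≈ lam ^ I′ + w * q ⟨mod P ⟩
    lifted = ≈-lift p (>-nonZero⁻¹ p) (shift-power t I u≈ I′≈)
    w : ℕ
    w = proj₁ lifted
    uλ^I≈ : u * lam ^ I ≈ lam ^ I′ + w * q ⟨mod P ⟩
    uλ^I≈ = proj₂ lifted

  negate-step : ∀ {I x y x′ y′} → x′ ≈ (P ∸ 1) * y ⟨mod P ⟩ → y′ ≈ (P ∸ 1) * x ⟨mod P ⟩ →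
    Step I x y → Step I x′ y′
  negate-step {I} {x} {y} {x′} {y′} x′≈ y′≈ (step k k<p y≈) = step k k<p (begin
    y′                                    ≈⟨ y′≈ ⟩
    (P ∸ 1) * x                           ≡⟨ +-identityʳ ((P ∸ 1) * x) ⟨
    (P ∸ 1) * x + 0                       ≈⟨ +-congˡ-≈ ((P ∸ 1) * x) (minus-one≈ D 1≤P) ⟨
    (P ∸ 1) * x + (D + (P ∸ 1) * D)       ≡⟨ regroup (P ∸ 1) x D ⟩
    (P ∸ 1) * (x + D) + D                 ≈⟨ +-congʳ-≈ D (*-congˡ-≈ (P ∸ 1) y≈) ⟨
    (P ∸ 1) * y + D                       ≈⟨ +-congʳ-≈ D x′≈ ⟨
    x′ + D                                ∎)
    where
    open ≈-Reasoning P
    D : ℕ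
    D = k * q + lam ^ I
    regroup : ∀ m x D → m * x + (D + m * D) ≡ m * (x + D) + D
    regroup = solve-∀

  affine-layer : ∀ u c t x y → LayerAdj p (2 + m₀) n x y →
    LayerAdj p (2 + m₀) n (affine u c t x) (affine u c t y)
  affine-layer u c t (j , i) (.j , i′) (refl , succ) = refl , Sum.map shift shift succ
    where
    shift : ∀ {a b} → a ≡ b + 1 [mod Q ] → toℕ ((a + t) mod Q) ≡ toℕ ((b + t) mod Q) + 1 [mod Q ]
    shift {a} {b} a≡b+1 = ≈⇒≡[mod] (begin
      toℕ ((a + t) mod Q)       ≈⟨ layer-vertex 0 (a + t) ⟩
      a + t                     ≈⟨ +-congʳ-≈ t (≡[mod]⇒≈ a≡b+1) ⟩
      b + 1 + t                 ≡⟨ swap b t ⟩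
      b + t + 1                 ≈⟨ +-congʳ-≈ 1 (layer-vertex 0 (b + t)) ⟨
      toℕ ((b + t) mod Q) + 1   ∎)
      where
      open ≈-Reasoning Q
      swap : ∀ b t → b + 1 + t ≡ b + t + 1
      swap = solve-∀

  affine-Inner : ∀ {u} c t → u ≈ lam ^ t ⟨mod q ⟩ → ∀ x y → Inner x y →
    Inner (affine u c t x) (affine u c t y)
  affine-Inner {u} c t u≈ x y (same-layer , steps) =
    cong (λ i → (toℕ i + t) mod Q) same-layer ,
    Sum.map (scale-step t c u≈ I′≈ (pos-affine u c t x) (pos-affine u c t y))
            (scale-step t c u≈ I′≈ (pos-affine u c t y) (pos-affine u c t x)) steps
    where
    I′≈ : layer (affine u c t x) ≈ layer x + t ⟨mod Q ⟩
    I′≈ = layer-affine u c t x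

  affine-adj : ∀ {u} c t → u ≈ lam ^ t ⟨mod q ⟩ → ∀ x y → Adj x y → Adj (affine u c t x) (affine u c t y)
  affine-adj {u} c t u≈ x y (inj₁ inner) =
    inj₁ (Inner⇒inner (affine u c t x) (affine u c t y) (affine-Inner c t u≈ x y (inner⇒Inner x y inner)))
  affine-adj {u} c t u≈ x y (inj₂ layer-edge) = inj₂ (affine-layer u c t x y layer-edge)

  negate : V → V
  negate = affine (P ∸ 1) 0 0

  negate-Inner : ∀ x y → Inner x y → Inner (negate x) (negate y)
  negate-Inner x y (same-layer , steps) =
    cong (λ i → (toℕ i + 0) mod Q) same-layer , Sum.swap (Sum.map (reflect x y) (reflect y x) steps)
    where
    pos≈ : ∀ z → pos (negate z) ≈ (P ∸ 1) * pos z ⟨mod P ⟩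
    pos≈ z = ≈-trans (pos-affine (P ∸ 1) 0 0 z) (≡⇒≈ (+-identityʳ ((P ∸ 1) * pos z)))
    reflect : ∀ a b → Step (layer x) (pos a) (pos b) → Step (layer (negate x)) (pos (negate b)) (pos (negate a))
    reflect a b s = subst (λ I → Step I (pos (negate b)) (pos (negate a))) (sym (layer-affine-0 (P ∸ 1) 0 x))
                          (negate-step (pos≈ b) (pos≈ a) s)

  negate-adj : ∀ x y → Adj x y → Adj (negate x) (negate y)
  negate-adj x y (inj₁ inner) = inj₁ (Inner⇒inner (negate x) (negate y) (negate-Inner x y (inner⇒Inner x y inner)))
  negate-adj x y (inj₂ layer-edge) = inj₂ (affine-layer (P ∸ 1) 0 0 x y layer-edge)

  -- An affine map with u ≡ λ^t (mod q) and u a unit modulo P is an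
  -- automorphism.  Its inverse is the affine map with multiplier v = u⁻¹,
  -- and v ≡ λ^(−t) (mod q) because λ^Q ≡ 1 (mod q).
  affine-aut : ∀ u v c t → u * v ≈ 1 ⟨mod P ⟩ → u ≈ lam ^ t ⟨mod q ⟩ → Aut Adj
  affine-aut u v c t uv≈1 u≈ =
    aut-from-inverses Adj (affine u c t) (affine v c′ t′) right-inverse left-inverse
      (affine-adj c t u≈) (affine-adj c′ t′ v≈)
    where
    c′ t′ : ℕ
    c′ = (P ∸ 1) * (v * c)
    t′ = (Q ∸ 1) * t
    vu≈1 : v * u ≈ 1 ⟨mod P ⟩
    vu≈1 = ≈-trans (≡⇒≈ (*-comm v u)) uv≈1
    t+t′≈0 : t + t′ ≈ 0 ⟨mod Q ⟩
    t+t′≈0 = minus-one≈ t 1≤Q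
    v≈ : v ≈ lam ^ t′ ⟨mod q ⟩
    v≈ = begin
      v                          ≡⟨ *-identityʳ v ⟨
      v * 1                      ≈⟨ *-congˡ-≈ v (lam-power-cong t+t′≈0) ⟨
      v * lam ^ (t + t′)         ≡⟨ cong (v *_) (^-distribˡ-+-* lam t t′) ⟩
      v * (lam ^ t * lam ^ t′)   ≡⟨ *-assoc v (lam ^ t) (lam ^ t′) ⟨
      v * lam ^ t * lam ^ t′     ≈⟨ *-congʳ-≈ (lam ^ t′) (*-congˡ-≈ v u≈) ⟨
      v * u * lam ^ t′           ≈⟨ *-congʳ-≈ (lam ^ t′) (∣-≈ q∣P vu≈1) ⟩
      1 * lam ^ t′               ≡⟨ *-identityˡ (lam ^ t′) ⟩
      lam ^ t′                   ∎
      where open ≈-Reasoning q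
    uc′+c≈0 : u * c′ + c ≈ 0 ⟨mod P ⟩
    uc′+c≈0 = begin
      u * ((P ∸ 1) * (v * c)) + c   ≡⟨ regroup u (P ∸ 1) v c ⟩
      c + (P ∸ 1) * (u * v * c)     ≈⟨ +-congˡ-≈ c (*-congˡ-≈ (P ∸ 1) (*-congʳ-≈ c uv≈1)) ⟩
      c + (P ∸ 1) * (1 * c)         ≡⟨ cong (λ z → c + (P ∸ 1) * z) (*-identityˡ c) ⟩
      c + (P ∸ 1) * c               ≈⟨ minus-one≈ c 1≤P ⟩
      0                             ∎
      where
      open ≈-Reasoning P
      regroup : ∀ u m v c → u * (m * (v * c)) + c ≡ c + m * (u * v * c)
      regroup = solve-∀
    right-inverse : ∀ x → affine u c t (affine v c′ t′ x) ≡ x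
    right-inverse x = trans (affine-∘ u c t v c′ t′ x)
      (affine-identity uv≈1 uc′+c≈0 (≈-trans (≡⇒≈ (+-comm t′ t)) t+t′≈0) x)
    left-inverse : ∀ x → affine v c′ t′ (affine u c t x) ≡ x
    left-inverse x = trans (affine-∘ v c′ t′ u c t x)
      (affine-identity vu≈1 (minus-one≈ (v * c) 1≤P) t+t′≈0 x)

  negate-aut : Aut Adj
  negate-aut = aut-from-inverses Adj negate negate involution involution negate-adj negate-adj
    where
    involution : ∀ x → negate (negate x) ≡ x
    involution x = trans (affine-∘ (P ∸ 1) 0 0 (P ∸ 1) 0 0 x)
      (affine-identity (minus-one-squared 1≤P) (≡⇒≈ (cong (_+ 0) (*-zeroʳ (P ∸ 1)))) (≈-refl {a = 0}) x)

  b₀ b₁ : V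
  b₀ = vertex 0 0
  b₁ = vertex 1 0

  σA τA : Aut Adj
  σA = affine-aut 1 1 1 0 ≈-refl ≈-refl
  τA = affine-aut lam lam⁻¹ 0 1 lam-unit (≡⇒≈ (sym (*-identityʳ lam)))

  σ τ : V → V
  σ = apply Adj σA
  τ = apply Adj τA

  σ-power : ∀ d x → iter d σ x ≡ affine 1 d 0 x
  σ-power zero    x = sym (affine-identity ≈-refl ≈-refl ≈-refl x)
  σ-power (suc d) x = begin
    σ (iter d σ x)                ≡⟨ cong σ (σ-power d x) ⟩
    σ (affine 1 d 0 x)            ≡⟨ affine-∘ 1 1 0 1 d 0 x ⟩
    affine 1 (1 * d + 1) 0 x
      ≡⟨ affine-cong (≈-refl {a = 1}) (≡⇒≈ (trans (+-comm (1 * d) 1) (cong suc (*-identityˡ d)))) (≈-refl {a = 0}) x ⟩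
    affine 1 (suc d) 0 x          ∎
    where open ≡-Reasoning

  τ-power : ∀ d x → iter d τ x ≡ affine (lam ^ d) 0 d x
  τ-power zero    x = sym (affine-identity ≈-refl ≈-refl ≈-refl x)
  τ-power (suc d) x = begin
    τ (iter d τ x)                          ≡⟨ cong τ (τ-power d x) ⟩
    τ (affine (lam ^ d) 0 d x)              ≡⟨ affine-∘ lam 0 1 (lam ^ d) 0 d x ⟩
    affine (lam ^ suc d) (lam * 0 + 0) (d + 1) x
      ≡⟨ affine-cong (≈-refl {a = lam ^ suc d}) (≡⇒≈ (cong (_+ 0) (*-zeroʳ lam))) (≡⇒≈ (+-comm d 1)) x ⟩
    affine (lam ^ suc d) 0 (suc d) x        ∎
    where open ≡-Reasoning

  translation-trivial : ∀ {d} → d ≈ 0 ⟨mod P ⟩ → ∀ x → affine 1 d 0 x ≡ x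
  translation-trivial d≈0 = affine-identity ≈-refl d≈0 ≈-refl

  translation-fixes : ∀ {d} x → affine 1 d 0 x ≡ x → d ≈ 0 ⟨mod P ⟩
  translation-fixes {d} x fixed = +-cancelˡ-≈ (pos x) (begin
    pos x + d                   ≡⟨ cong (_+ d) (*-identityˡ (pos x)) ⟨
    1 * pos x + d               ≈⟨ pos-affine 1 d 0 x ⟨
    pos (affine 1 d 0 x)        ≡⟨ cong pos fixed ⟩
    pos x                       ≡⟨ +-identityʳ (pos x) ⟨
    pos x + 0                   ∎)
    where open ≈-Reasoning P

  σ-period : ∀ x → iter P σ x ≡ x
  σ-period x = trans (σ-power P x) (translation-trivial (+-modulus≈ {P} 0) x)

  σ-order : ∀ d → 0 < d → d < P → ¬ (∀ x → iter d σ x ≡ x)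
  σ-order d 0<d d<P all-fixed = <⇒≢ 0<d (sym (≈-residue d<P 0<P d≈0))
    where
    0<P : 0 < P
    0<P = m^n>0 p (2 + m₀)
    d≈0 : d ≈ 0 ⟨mod P ⟩
    d≈0 = translation-fixes b₀ (trans (sym (σ-power d b₀)) (all-fixed b₀))

  σ-semiregular : ∀ d x → iter d σ x ≡ x → ∀ y → iter d σ y ≡ y
  σ-semiregular d x fixed y =
    trans (σ-power d y) (translation-trivial (translation-fixes x (trans (sym (σ-power d x)) fixed)) y)

  -- τ σ τ⁻¹ = σ^λ, both sides being the map (j , i) ↦ (λ·j + λ , i + 1).
  τ-normalizes-σ : ∀ x → τ (σ x) ≡ iter lam σ (τ x)
  τ-normalizes-σ x = begin
    τ (σ x)                            ≡⟨ affine-∘ lam 0 1 1 1 0 x ⟩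
    affine (lam * 1) (lam * 1 + 0) 1 x
      ≡⟨ affine-cong (≡⇒≈ (*-comm lam 1)) (≡⇒≈ (trans (+-identityʳ (lam * 1)) (*-identityʳ lam))) (≈-refl {a = 1}) x ⟩
    affine (1 * lam) lam 1 x           ≡⟨ affine-∘ 1 lam 0 lam 0 1 x ⟨
    affine 1 lam 0 (τ x)               ≡⟨ σ-power lam (τ x) ⟨
    iter lam σ (τ x)                   ∎
    where open ≡-Reasoning

  orbit⇒same-layer : ∀ {x y} → SameOrbit σ x y → layer x ≡ layer y
  orbit⇒same-layer {x} (d , σ^dx≡y) =
    trans (sym (layer-affine-0 1 d x)) (trans (cong layer (sym (σ-power d x))) (cong layer σ^dx≡y))

  same-layer⇒orbit : ∀ {x y} → layer x ≡ layer y → SameOrbit σ x y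
  same-layer⇒orbit {x} {y} same = pos y + (P ∸ pos x) , trans (σ-power (pos y + (P ∸ pos x)) x) (vertex≡ y
    (begin
      1 * pos x + (pos y + (P ∸ pos x))   ≡⟨ cong (_+ (pos y + (P ∸ pos x))) (*-identityˡ (pos x)) ⟩
      pos x + (pos y + (P ∸ pos x))       ≡⟨ x+[y+z]≡y+[x+z] (pos x) (pos y) (P ∸ pos x) ⟩
      pos y + (pos x + (P ∸ pos x))       ≡⟨ cong (pos y +_) (m+[n∸m]≡n (<⇒≤ (toℕ<n (proj₁ x)))) ⟩
      pos y + P                           ≈⟨ +-modulus≈ (pos y) ⟩
      pos y                               ∎)
    (≡⇒≈ (trans (+-identityʳ (layer x)) same)))
    where
    open ≈-Reasoning P
    x+[y+z]≡y+[x+z] : ∀ x y z → x + (y + z) ≡ y + (x + z)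
    x+[y+z]≡y+[x+z] = solve-∀

  τ-power-layer : ∀ a x → layer (iter a τ x) ≈ layer x + a ⟨mod Q ⟩
  τ-power-layer a x = ≈-trans (≡⇒≈ (cong layer (τ-power a x))) (layer-affine (lam ^ a) 0 a x)

  τ-power-moves-layer : ∀ a x → 0 < a → a < Q → layer (iter a τ x) ≢ layer x
  τ-power-moves-layer a x 0<a a<Q same = <⇒≢ 0<a (sym (≈-residue a<Q (m^n>0 p n) a≈0))
    where
    a≈0 : a ≈ 0 ⟨mod Q ⟩
    a≈0 = +-cancelˡ-≈ (layer x) (≈-trans (≈-sym (τ-power-layer a x))
            (≡⇒≈ (trans same (sym (+-identityʳ (layer x))))))

  τ-permutes-orbits : ∀ x → SameOrbit σ x (iter Q τ x) × (∀ a → 0 < a → a < Q → ¬ SameOrbit σ x (iter a τ x))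
  τ-permutes-orbits x =
    same-layer⇒orbit {x} {iter Q τ x} (sym (≈-residue (toℕ<n (proj₂ (iter Q τ x))) (toℕ<n (proj₂ x))
                            (≈-trans (τ-power-layer Q x) (+-modulus≈ (layer x))))) ,
    λ a 0<a a<Q orbit → τ-power-moves-layer a x 0<a a<Q (sym (orbit⇒same-layer orbit))

  τ-cycle : Σ V λ x → iter Q τ x ≡ x × (∀ a → 0 < a → a < Q → ¬ iter a τ x ≡ x)
  τ-cycle = b₀ , trans (τ-power Q b₀) (vertex≡ b₀ pos≈ (+-modulus≈ {Q} (layer b₀))) ,
    λ a 0<a a<Q fixed → τ-power-moves-layer a b₀ 0<a a<Q (cong layer fixed)
    where
    pos≈ : lam ^ Q * pos b₀ + 0 ≈ pos b₀ ⟨mod P ⟩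
    pos≈ = begin
      lam ^ Q * pos b₀ + 0   ≈⟨ +-congʳ-≈ 0 (*-congˡ-≈ (lam ^ Q) (pos-vertex 0 0)) ⟩
      lam ^ Q * 0 + 0        ≡⟨ cong (_+ 0) (*-zeroʳ (lam ^ Q)) ⟩
      0                      ≈⟨ pos-vertex 0 0 ⟨
      pos b₀                 ∎
      where open ≈-Reasoning P

  metacirculant : IsMetacirculant (P * Q) Adj
  metacirculant = Q , P , 1≤Q , 2≤P , *-comm Q P , σA , τA ,
    σ-period , σ-order , σ-semiregular , (lam , τ-normalizes-σ) , τ-permutes-orbits , τ-cycle
    where
    2≤P : 2 ≤ P
    2≤P = ≤-trans (nonTrivial⇒n>1 p) (m≤m*n p (p ^ (1 + m₀)) {{m^n≢0 p (1 + m₀)}})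

  affine-b₀ : ∀ u c t x → c ≈ pos x ⟨mod P ⟩ → t ≈ layer x ⟨mod Q ⟩ → affine u c t b₀ ≡ x
  affine-b₀ u c t x c≈ t≈ = vertex≡ x
    (begin
      u * pos b₀ + c   ≈⟨ +-congʳ-≈ c (*-congˡ-≈ u (pos-vertex 0 0)) ⟩
      u * 0 + c        ≡⟨ cong (_+ c) (*-zeroʳ u) ⟩
      c                ≈⟨ c≈ ⟩
      pos x            ∎)
    (≈-trans (+-congʳ-≈ t (layer-vertex 0 0)) t≈)
    where open ≈-Reasoning P

  affine-b₁ : ∀ u c t y → u + c ≈ pos y ⟨mod P ⟩ → t ≈ layer y ⟨mod Q ⟩ → affine u c t b₁ ≡ y
  affine-b₁ u c t y u+c≈ t≈ = vertex≡ y
    (begin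
      u * pos b₁ + c   ≈⟨ +-congʳ-≈ c (*-congˡ-≈ u (pos-vertex 1 0)) ⟩
      u * 1 + c        ≡⟨ cong (_+ c) (*-identityʳ u) ⟩
      u + c            ≈⟨ u+c≈ ⟩
      pos y            ∎)
    (≈-trans (+-congʳ-≈ t (layer-vertex 1 0)) t≈)
    where open ≈-Reasoning P

  -- q² ≡ 0 (mod P), since m ≥ 2.
  q²≈0 : q * q ≈ 0 ⟨mod P ⟩
  q²≈0 = ≈-trans (≡⇒≈ (square p (p ^ m₀))) (multiple≈0 (p ^ m₀))
    where
    square : ∀ p r → (p * r) * (p * r) ≡ r * (p * (p * r))
    square = solve-∀

  one-plus-unit : ∀ k → (1 + k * q) * (1 + (P ∸ 1) * k * q) ≈ 1 ⟨mod P ⟩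
  one-plus-unit k = begin
    (1 + k * q) * (1 + (P ∸ 1) * k * q)                   ≡⟨ expand k q (P ∸ 1) ⟩
    1 + (k * q + (P ∸ 1) * (k * q)) + (P ∸ 1) * k * k * (q * q)
      ≈⟨ +-cong-≈ (+-congˡ-≈ 1 (minus-one≈ (k * q) 1≤P)) (*-congˡ-≈ ((P ∸ 1) * k * k) q²≈0) ⟩
    1 + 0 + (P ∸ 1) * k * k * 0                           ≡⟨ cong (1 +_) (*-zeroʳ ((P ∸ 1) * k * k)) ⟩
    1                                                     ∎
    where
    open ≈-Reasoning P
    expand : ∀ k q m → (1 + k * q) * (1 + m * k * q) ≡ 1 + (k * q + m * (k * q)) + m * k * k * (q * q)
    expand = solve-∀

  -- The multiplier λ^I·(1 + k·q) sends the base arc onto an E_I step with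
  -- coefficient k: it is a unit, ≡ λ^I (mod q), and ≡ k·q + λ^I (mod P).
  arc-multiplier : ℕ → ℕ → ℕ
  arc-multiplier I k = lam ^ I * (1 + k * q)

  arc-multiplier-unit : ∀ I k → arc-multiplier I k * (lam⁻¹ ^ I * (1 + (P ∸ 1) * k * q)) ≈ 1 ⟨mod P ⟩
  arc-multiplier-unit I k =
    unit-* {a = lam ^ I} {lam⁻¹ ^ I} {1 + k * q} {1 + (P ∸ 1) * k * q} (unit-^ I lam-unit) (one-plus-unit k)

  arc-multiplier-expand : ∀ I k → arc-multiplier I k ≡ lam ^ I + lam ^ I * k * q
  arc-multiplier-expand I k = expand (lam ^ I) k q
    where
    expand : ∀ l k q → l * (1 + k * q) ≡ l + l * k * q
    expand = solve-∀

  arc-multiplier≈power : ∀ I k → arc-multiplier I k ≈ lam ^ I ⟨mod q ⟩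
  arc-multiplier≈power I k = ≈-trans (≡⇒≈ (arc-multiplier-expand I k)) (+-multiple≈ (lam ^ I) (lam ^ I * k))

  arc-multiplier≈step : ∀ I k → arc-multiplier I k ≈ k * q + lam ^ I ⟨mod P ⟩
  arc-multiplier≈step I k = begin
    arc-multiplier I k          ≡⟨ arc-multiplier-expand I k ⟩
    lam ^ I + lam ^ I * k * q   ≈⟨ +-congˡ-≈ (lam ^ I) (*-scale-≈ q λ^Ik≈k) ⟩
    lam ^ I + k * q             ≡⟨ +-comm (lam ^ I) (k * q) ⟩
    k * q + lam ^ I             ∎
    where
    open ≈-Reasoning P
    λ^Ik≈k : lam ^ I * k ≈ k ⟨mod p ⟩
    λ^Ik≈k = ≈-trans (*-congʳ-≈ k (≈-trans (^-congˡ-≈ I lam≡1) (≡⇒≈ (^-zeroˡ I)))) (≡⇒≈ (*-identityˡ k))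

  arc-aut : ∀ I k c → Aut Adj
  arc-aut I k c = affine-aut (arc-multiplier I k) (lam⁻¹ ^ I * (1 + (P ∸ 1) * k * q)) c I
    (arc-multiplier-unit I k) (arc-multiplier≈power I k)

  forward-arc : ∀ x y → layer x ≡ layer y → Step (layer x) (pos x) (pos y) →
    Σ (Aut Adj) λ g → apply Adj g b₀ ≡ x × apply Adj g b₁ ≡ y
  forward-arc x y same (step k _ y≈) =
    arc-aut (layer x) k (pos x) ,
    affine-b₀ u (pos x) (layer x) x ≈-refl ≈-refl ,
    affine-b₁ u (pos x) (layer x) y u+x≈y (≡⇒≈ same)
    where
    u : ℕ
    u = arc-multiplier (layer x) k
    u+x≈y : u + pos x ≈ pos y ⟨mod P ⟩
    u+x≈y = begin
      u + pos x                                ≈⟨ +-congʳ-≈ (pos x) (arc-multiplier≈step (layer x) k) ⟩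
      k * q + lam ^ layer x + pos x            ≡⟨ +-comm (k * q + lam ^ layer x) (pos x) ⟩
      pos x + (k * q + lam ^ layer x)          ≈⟨ y≈ ⟨
      pos y                                    ∎
      where open ≈-Reasoning P

  backward-arc : ∀ x y → layer x ≡ layer y → Step (layer x) (pos y) (pos x) →
    Σ (Aut Adj) λ g → apply Adj g b₀ ≡ x × apply Adj g b₁ ≡ y
  backward-arc x y same (step k _ x≈) =
    aut-compose Adj (arc-aut (layer x) k (pos x)) negate-aut ,
    trans (affine-∘ u (pos x) (layer x) (P ∸ 1) 0 0 b₀)
          (affine-b₀ (u * (P ∸ 1)) (u * 0 + pos x) (0 + layer x) x (≡⇒≈ (cong (_+ pos x) (*-zeroʳ u))) ≈-refl) ,
    trans (affine-∘ u (pos x) (layer x) (P ∸ 1) 0 0 b₁)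
          (affine-b₁ (u * (P ∸ 1)) (u * 0 + pos x) (0 + layer x) y reflected (≡⇒≈ same))
    where
    u : ℕ
    u = arc-multiplier (layer x) k
    reflected : u * (P ∸ 1) + (u * 0 + pos x) ≈ pos y ⟨mod P ⟩
    reflected = begin
      u * (P ∸ 1) + (u * 0 + pos x)       ≡⟨ cong (λ z → u * (P ∸ 1) + (z + pos x)) (*-zeroʳ u) ⟩
      u * (P ∸ 1) + pos x                 ≈⟨ +-congˡ-≈ (u * (P ∸ 1)) x≈ ⟩
      u * (P ∸ 1) + (pos y + (k * q + lam ^ layer x))
        ≈⟨ +-congˡ-≈ (u * (P ∸ 1)) (+-congˡ-≈ (pos y) (arc-multiplier≈step (layer x) k)) ⟨
      u * (P ∸ 1) + (pos y + u)           ≡⟨ regroup u (P ∸ 1) (pos y) ⟩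
      pos y + (u + (P ∸ 1) * u)           ≈⟨ +-congˡ-≈ (pos y) (minus-one≈ u 1≤P) ⟩
      pos y + 0                           ≡⟨ +-identityʳ (pos y) ⟩
      pos y                               ∎
      where
      open ≈-Reasoning P
      regroup : ∀ u m y → u * m + (y + u) ≡ y + (u + m * u)
      regroup = solve-∀

  arc-transitive : ArcTransitiveOn Adj (InnerAdj p (2 + m₀) n lam)
  arc-transitive = arc-transitive-via-base Adj b₀ b₁ reach
    where
    reach : ∀ x y → InnerAdj p (2 + m₀) n lam x y → Σ (Aut Adj) λ g → apply Adj g b₀ ≡ x × apply Adj g b₁ ≡ y
    reach x y inner with inner⇒Inner x y inner
    ... | same , inj₁ forward  = forward-arc x y (cong toℕ same) forward
    ... | same , inj₂ backward = backward-arc x y (cong toℕ same) backward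

lemma6p2 : (p m n lam : ℕ) → Prime p → ¬ (2 ∣ p) → n + 2 ≤ m → 3 ≤ n + 2 →
    IsUnitMod (p ^ m) lam → HasMulOrder (p ^ m) lam (p ^ (n + 1)) →
    IsMetacirculant (p ^ m * p ^ n) (MPAdj p m n lam) ×
    ArcTransitiveOn (MPAdj p m n lam) (InnerAdj p m n lam)
lemma6p2 p (suc (suc m₀)) n lam prime-p 2∤p _ _ _ (_ , order , _) =
  Graph.metacirculant , Graph.arc-transitive
  where
  instance
    p-nontrivial : NonTrivial p
    p-nontrivial = prime⇒nonTrivial prime-p
    p-nonzero : NonZero p
    p-nonzero = prime⇒nonZero prime-p
  order′ : lam ^ (p ^ suc n) ≈ 1 ⟨mod p ^ (2 + m₀) ⟩
  order′ = subst (λ e → lam ^ (p ^ e) ≈ 1 ⟨mod p ^ (2 + m₀) ⟩) (+-comm n 1) (≡[mod]⇒≈ order)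
  lam-unit : lam * lam ^ (p ^ suc n ∸ 1) ≈ 1 ⟨mod p ^ (2 + m₀) ⟩
  lam-unit = ≈-trans (≡⇒≈ (cong (lam ^_) (suc-pred (p ^ suc n) {{m^n≢0 p (suc n)}}))) order′
  module Graph = MP p m₀ n lam (lam ^ (p ^ suc n ∸ 1)) lam-unit
    (≡1-mod-prime prime-p (suc m₀) n lam order′)
    (order-descent prime-p 2∤p (suc m₀) n lam order′)
lemma6p2 p zero          n lam _ _ n+2≤m _ _ _ = ⊥-elim (<⇒≱ (s≤s z≤n) (≤-trans (m≤n+m 2 n) n+2≤m))
lemma6p2 p (suc zero)    n lam _ _ n+2≤m _ _ _ = ⊥-elim (<⇒≱ (s≤s (s≤s z≤n)) (≤-trans (m≤n+m 2 n) n+2≤m))
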